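{- Fix $n \in \mathbb{N}$ and let $G_{1}$ and $G_{2}$ be two graphs with $n$ vertices. The $\textsc{Greedy}$ algorithm (described in the context) with input $(G_{1}, G_{2})$ runs in $O(n^{3})$ time. In addition, if $(G_{1}, G_{2}) \sim \mathbb{G}(n,1/2)^{\otimes 2}$, then with probability tending to $1$ as $n\to\infty$, $\textsc{Greedy}(G_{1}, G_{2})$ runs in $O(n^{2} \log n)$ time.
   Context: $\mathbb{G}(n,1/2)^{\otimes 2}$ denotes two independent Erdős–Rényi random graphs on $[n]$ with edge probability $1/2$. The algorithm $\textsc{Greedy}(G_1,G_2)$: fix arbitrary orderings $u_1,\dots,u_n$ of $V(G_1)$ and $v_1,\dots,v_n$ of $V(G_2)$; initialize $S_1=S_2=\emptyset$ and $\pi$ the empty map. For $i=1,\dots,n$: for $j=1,\dots,i$ in order, until a pair has been added in iteration $i$: if $v_j\notin S_2$ and the check "for all $u'\in S_1$, $(u_i,u')\in E(G_1)\iff(v_j,\pi(u'))\in E(G_2)$" succeeds (this check is performed in time $O(|S_1|)$), then add $u_i$ to $S_1$, $v_j$ to $S_2$, set $\pi(u_i):=v_j$ and stop iteration $i$; else if $u_j\notin S_1$ and the analogous check for $(u_j,v_i)$ succeeds, then add $u_j$ to $S_1$, $v_i$ to $S_2$, set $\pi(u_j):=v_i$ and stop iteration $i$; otherwise increase $j$. Output $G_1[S_1]$, $G_2[S_2]$, $\pi$. -}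

module Defs where

open import Data.Bool using (Bool; true; false; if_then_else_; _∧_; not)
open import Data.Nat using (ℕ; zero; suc; _+_; _*_; _^_; _≤ᵇ_)
open import Data.Fin using (Fin; zero; suc; toℕ; _≟_)
open import Data.Vec using (Vec; []; _∷_; lookup)
open import Data.List as List using (List; []; _∷_; length; allFin; foldl; map; concatMap; cartesianProduct)
open import Data.Product using (_×_; _,_; proj₁; proj₂)
open import Data.Unit using (⊤; tt)
open import Relation.Nullary using (does)

-- A graph on suc n vertices is a graph on the vertices 1..n (shifted by
-- suc) together with the adjacency vector of the new vertex 0.
-- This representation is in bijection with simple (loopless, undirected)
-- graphs on Fin n, i.e. with subsets of the set of unordered pairs.

Graph : ℕ → Set
Graph zero    = ⊤
Graph (suc n) = Graph n × Vec Bool n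

adj : ∀ {n} → Graph n → Fin n → Fin n → Bool
adj {suc n} (g , v) zero    zero    = false
adj {suc n} (g , v) zero    (suc j) = lookup v j
adj {suc n} (g , v) (suc i) zero    = lookup v i
adj {suc n} (g , v) (suc i) (suc j) = adj g i j

allVec : ∀ n → List (Vec Bool n)
allVec zero    = [] ∷ []
allVec (suc n) = concatMap (λ v → (true ∷ v) ∷ (false ∷ v) ∷ []) (allVec n)

allGraphs : ∀ n → List (Graph n)
allGraphs zero    = tt ∷ []
allGraphs (suc n) = cartesianProduct (allGraphs n) (allVec n)

-- Orderings: u_i = v_i = the vertex i of Fin n (0-based).
-- The state is the list of matched pairs (u , π u); S₁ / S₂ are its
-- first / second projections, |S₁| = length of the list.

Matching : ℕ → Set
Matching n = List (Fin n × Fin n)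

beq : Bool → Bool → Bool
beq true  b = b
beq false b = not b

anyᵇ : {A : Set} → (A → Bool) → List A → Bool
anyᵇ p []       = false
anyᵇ p (x ∷ xs) = p x Data.Bool.∨ anyᵇ p xs

allᵇ : {A : Set} → (A → Bool) → List A → Bool
allᵇ p []       = true
allᵇ p (x ∷ xs) = p x ∧ allᵇ p xs

inS₁ : ∀ {n} → Fin n → Matching n → Bool
inS₁ u ps = anyᵇ (λ p → does (proj₁ p ≟ u)) ps

inS₂ : ∀ {n} → Fin n → Matching n → Bool
inS₂ v ps = anyᵇ (λ p → does (proj₂ p ≟ v)) ps

check : ∀ {n} → Graph n → Graph n → Fin n → Fin n → Matching n → Bool
check G₁ G₂ u v ps = allᵇ (λ p → beq (adj G₁ u (proj₁ p)) (adj G₂ v (proj₂ p))) ps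

-- cost of one check: |S₁| + 1   (the check runs in time O(|S₁|))
checkCost : ∀ {n} → Matching n → ℕ
checkCost ps = suc (length ps)

-- Each attempted j costs 1
-- (bookkeeping / membership tests, O(1) with arrays) plus the cost of
-- every check actually performed.
tryJ : ∀ {n} → Graph n → Graph n → Fin n → List (Fin n) → Matching n → Matching n × ℕ
tryJ {n} G₁ G₂ i []       ps = ps , 0
tryJ {n} G₁ G₂ i (j ∷ js) ps =
  if not (inS₂ j ps)
  then (if check G₁ G₂ i j ps
        then (((i , j) ∷ ps) , suc (checkCost ps))
        else second (checkCost ps))
  else second 0
  where
  rest : ℕ → Matching n × ℕ
  rest c₁ with tryJ G₁ G₂ i js ps
  ... | (ps' , c) = ps' , suc (c₁ + c)
  second : ℕ → Matching n × ℕ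
  second c₁ =
    if not (inS₁ j ps)
    then (if check G₁ G₂ j i ps
          then (((j , i) ∷ ps) , suc (c₁ + checkCost ps))
          else rest (c₁ + checkCost ps))
    else rest c₁

-- j ranges over 1..i (1-based), i.e. 0..i (0-based)
upToFin : ∀ {n} → Fin n → List (Fin n)
upToFin {n} i = List.filter (λ j → Data.Nat._≤?_ (toℕ j) (toℕ i)) (allFin n)

greedyRun : ∀ {n} → Graph n → Graph n → Matching n × ℕ
greedyRun {n} G₁ G₂ = foldl step ([] , 0) (allFin n)
  where
  step : Matching n × ℕ → Fin n → Matching n × ℕ
  step (ps , c) i with tryJ G₁ G₂ i (upToFin i) ps
  ... | (ps' , c') = ps' , (c + suc c')

greedyTime : ∀ {n} → Graph n → Graph n → ℕ
greedyTime G₁ G₂ = proj₂ (greedyRun G₁ G₂)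

greedyMatching : ∀ {n} → Graph n → Graph n → Matching n
greedyMatching G₁ G₂ = proj₁ (greedyRun G₁ G₂)

-- G(n,1/2)^{⊗2}: the uniform distribution on pairs of graphs on [n].
-- Probabilities are expressed by counting.

countᵇ : {A : Set} → (A → Bool) → List A → ℕ
countᵇ p []       = 0
countᵇ p (x ∷ xs) = if p x then suc (countᵇ p xs) else countᵇ p xs

allPairs : ∀ n → List (Graph n × Graph n)
allPairs n = cartesianProduct (allGraphs n) (allGraphs n)

badCount : (n bound : ℕ) → ℕ
badCount n bound = countᵇ (λ p → not (greedyTime (proj₁ p) (proj₂ p) ≤ᵇ bound)) (allPairs n)

totalCount : ℕ → ℕ
totalCount n = length (allPairs n)

{-# OPTIONS --safe #-}
-- Each iteration of Greedy tries at most n values of j, each costing one step and two checks of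
-- cost |S₁| + 1, so a run whose output has s pairs costs O(n² (s + 1)) steps: O(n³) always, and
-- O(n² log n) unless s ≥ m = 8 (⌊log₂ n⌋ + 1). In that case the first m pairs added form a
-- consistent matching σ: its second coordinates are distinct and, for fixed G₁, it prescribes the
-- adjacency in G₂ of all m(m-1)/2 pairs of these vertices. These are independent constraints on
-- distinct edges, each satisfied by exactly half of the graphs (toggling the edge is a bijection
-- that flips it), so σ is consistent for at most a 2^{-m(m-1)/2} fraction of the pairs (G₁ , G₂).
-- A union bound over the n^{2m} candidates σ leaves a fraction n^{2m} 2^{-m(m-1)/2} ≤ 1/(k+1) of
-- slow inputs once n ≥ 2^{k+1}.
module Submission where

open import Defs
open import Data.Bool using (Bool; true; false; not; _∧_; _∨_; _xor_; if_then_else_; T)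
open import Data.Bool.Properties using (∨-comm; ∧-comm; ∧-assoc; not-involutive; not-injective; ∧-conicalˡ; ∧-conicalʳ)
open import Data.Empty using (⊥-elim)
open import Data.Fin using (Fin; zero; suc; _≟_; toℕ)
open import Data.List using (List; []; _∷_; length; map; _++_; concatMap; cartesianProduct; cartesianProductWith; allFin; foldl; drop; tabulate)
open import Data.List.Properties using (map-++; map-cong; map-∘; length-++; length-map; length-drop; length-filter; length-tabulate)
open import Data.List.Membership.Propositional using (_∈_)
open import Data.List.Membership.Propositional.Properties using (∈-allFin; ∈-cartesianProduct⁺; ∈-cartesianProductWith⁺; ∈-cartesianProductWith⁻)
open import Data.List.Relation.Unary.All using (All; []; _∷_)
import Data.List.Relation.Unary.All as All
import Data.List.Relation.Unary.All.Properties as All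
open import Data.List.Relation.Unary.AllPairs using (AllPairs; []; _∷_; allPairs?)
import Data.List.Relation.Unary.AllPairs.Properties as AllPairs
open import Data.List.Relation.Unary.Any using (here; there)
open import Data.Nat using (ℕ; zero; suc; _+_; _*_; _^_; _∸_; _≤_; _<_; z≤n; s≤s; _≤ᵇ_; _≤?_)
open import Data.Nat.Combinatorics using (_C_; nC1≡n; nCk+nC[k+1]≡[n+1]C[k+1])
open import Data.Nat.ListAction using (sum)
open import Data.Nat.ListAction.Properties using (sum-++)
open import Data.Nat.Logarithm using (⌊log₂_⌋; ⌊log₂⌋-mono-≤; ⌊log₂[2^n]⌋≡n)
open import Data.Nat.Properties hiding (_≟_)
open import Algebra.Properties.CommutativeSemigroup +-commutativeSemigroup using (interchange)
open import Data.Nat.Tactic.RingSolver using (solve-∀)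
open import Data.Product using (∃-syntax; _×_; _,_; proj₁; proj₂; swap)
open import Data.Unit using (tt)
open import Data.Vec using (Vec; []; _∷_; zipWith)
import Data.Vec as Vec
open import Data.Vec.Properties using (lookup-zipWith; lookup∘tabulate)
open import Function using (_∘_; id)
open import Relation.Binary.PropositionalEquality
open import Relation.Nullary using (does; yes; no; ¬?)
open import Relation.Nullary.Decidable using (dec-true)

private
  variable
    A B X : Set
    n : ℕ

∑ : List A → (A → ℕ) → ℕ
∑ xs f = sum (map f xs)

indicator : Bool → ℕ
indicator b = if b then 1 else 0

∑-cong : {f g : A → ℕ} → (∀ x → f x ≡ g x) → ∀ xs → ∑ xs f ≡ ∑ xs g
∑-cong f≗g xs = cong sum (map-cong f≗g xs)

∑-mono : {f g : A → ℕ} → (∀ x → f x ≤ g x) → ∀ xs → ∑ xs f ≤ ∑ xs g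
∑-mono f≤g []       = z≤n
∑-mono f≤g (x ∷ xs) = +-mono-≤ (f≤g x) (∑-mono f≤g xs)

∑-++ : (f : A → ℕ) → ∀ xs ys → ∑ (xs ++ ys) f ≡ ∑ xs f + ∑ ys f
∑-++ f xs ys = trans (cong sum (map-++ f xs ys)) (sum-++ (map f xs) (map f ys))

∑-+ : (f g : A → ℕ) → ∀ xs → ∑ xs (λ x → f x + g x) ≡ ∑ xs f + ∑ xs g
∑-+ f g []       = refl
∑-+ f g (x ∷ xs) = trans (cong (f x + g x +_) (∑-+ f g xs)) (interchange (f x) (g x) (∑ xs f) (∑ xs g))

∑-zero : (xs : List A) → ∑ xs (λ _ → 0) ≡ 0
∑-zero []       = refl
∑-zero (x ∷ xs) = ∑-zero xs

∈⇒≤∑ : (f : A → ℕ) → ∀ {x xs} → x ∈ xs → f x ≤ ∑ xs f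
∈⇒≤∑ f {xs = y ∷ ys} (here refl) = m≤m+n (f y) (∑ ys f)
∈⇒≤∑ f {xs = y ∷ ys} (there x∈ys) = ≤-trans (∈⇒≤∑ f x∈ys) (m≤n+m (∑ ys f) (f y))

∑-*-bounded : (f : A → ℕ) (k c : ℕ) → ∀ xs → (∀ {x} → x ∈ xs → f x * k ≤ c) → ∑ xs f * k ≤ length xs * c
∑-*-bounded f k c []       _     = z≤n
∑-*-bounded f k c (x ∷ xs) bound = begin
  (f x + ∑ xs f) * k     ≡⟨ *-distribʳ-+ k (f x) (∑ xs f) ⟩
  f x * k + ∑ xs f * k   ≤⟨ +-mono-≤ (bound (here refl)) (∑-*-bounded f k c xs (bound ∘ there)) ⟩
  c + length xs * c      ∎
  where open ≤-Reasoning

∑-map : (f : B → ℕ) (g : A → B) → ∀ xs → ∑ (map g xs) f ≡ ∑ xs (f ∘ g)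
∑-map f g xs = cong sum (sym (map-∘ xs))

∑-concatMap : (f : B → ℕ) (g : A → List B) → ∀ xs → ∑ (concatMap g xs) f ≡ ∑ xs (λ x → ∑ (g x) f)
∑-concatMap f g []       = refl
∑-concatMap f g (x ∷ xs) = trans (∑-++ f (g x) (concatMap g xs)) (cong (∑ (g x) f +_) (∑-concatMap f g xs))

∑-cartesianProduct : (f : A × B → ℕ) → ∀ xs ys →
                     ∑ (cartesianProduct xs ys) f ≡ ∑ xs (λ x → ∑ ys (λ y → f (x , y)))
∑-cartesianProduct f []       ys = refl
∑-cartesianProduct f (x ∷ xs) ys =
  trans (∑-++ f (map (x ,_) ys) (cartesianProduct xs ys))
        (cong₂ _+_ (∑-map f (x ,_) ys) (∑-cartesianProduct f xs ys))

∑-swap : (f : A → B → ℕ) → ∀ xs ys → ∑ xs (λ x → ∑ ys (f x)) ≡ ∑ ys (λ y → ∑ xs (λ x → f x y))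
∑-swap f []       ys = sym (∑-zero ys)
∑-swap f (x ∷ xs) ys =
  trans (cong (∑ ys (f x) +_) (∑-swap f xs ys)) (sym (∑-+ (f x) (λ y → ∑ xs (λ x′ → f x′ y)) ys))

length-cartesianProductWith : (g : A → B → X) → ∀ xs ys →
                              length (cartesianProductWith g xs ys) ≡ length xs * length ys
length-cartesianProductWith g []       ys = refl
length-cartesianProductWith g (x ∷ xs) ys = begin
  length (map (g x) ys ++ cartesianProductWith g xs ys)      ≡⟨ length-++ (map (g x) ys) ⟩
  length (map (g x) ys) + length (cartesianProductWith g xs ys) ≡⟨ cong₂ _+_ (length-map (g x) ys) (length-cartesianProductWith g xs ys) ⟩
  length ys + length xs * length ys                         ∎
  where open ≡-Reasoning

indicator-mono : ∀ {a b} → (a ≡ true → b ≡ true) → indicator a ≤ indicator b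
indicator-mono {false} _    = z≤n
indicator-mono {true}  a⇒b rewrite a⇒b refl = ≤-refl

indicator-split : ∀ a b → indicator b ≡ indicator (a ∧ b) + indicator (not a ∧ b)
indicator-split true  b = sym (+-identityʳ (indicator b))
indicator-split false b = refl

countᵇ-as-∑ : (p : A → Bool) → ∀ xs → countᵇ p xs ≡ ∑ xs (indicator ∘ p)
countᵇ-as-∑ p []       = refl
countᵇ-as-∑ p (x ∷ xs) with p x
... | true  = cong suc (countᵇ-as-∑ p xs)
... | false = countᵇ-as-∑ p xs

countᵇ-cong : {p q : A → Bool} → (∀ x → p x ≡ q x) → ∀ xs → countᵇ p xs ≡ countᵇ q xs
countᵇ-cong {p = p} {q} p≗q xs = begin
  countᵇ p xs           ≡⟨ countᵇ-as-∑ p xs ⟩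
  ∑ xs (indicator ∘ p)  ≡⟨ ∑-cong (cong indicator ∘ p≗q) xs ⟩
  ∑ xs (indicator ∘ q)  ≡⟨ countᵇ-as-∑ q xs ⟨
  countᵇ q xs           ∎
  where open ≡-Reasoning

countᵇ-mono : {p q : A → Bool} → (∀ x → p x ≡ true → q x ≡ true) → ∀ xs → countᵇ p xs ≤ countᵇ q xs
countᵇ-mono {p = p} {q} p⇒q xs = begin
  countᵇ p xs           ≡⟨ countᵇ-as-∑ p xs ⟩
  ∑ xs (indicator ∘ p)  ≤⟨ ∑-mono (indicator-mono ∘ p⇒q) xs ⟩
  ∑ xs (indicator ∘ q)  ≡⟨ countᵇ-as-∑ q xs ⟨
  countᵇ q xs           ∎
  where open ≤-Reasoning

countᵇ-true : (xs : List A) → countᵇ (λ _ → true) xs ≡ length xs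
countᵇ-true []       = refl
countᵇ-true (x ∷ xs) = cong suc (countᵇ-true xs)

countᵇ-false : (xs : List A) → countᵇ (λ _ → false) xs ≡ 0
countᵇ-false []       = refl
countᵇ-false (x ∷ xs) = countᵇ-false xs

countᵇ-split : (q p : A → Bool) → ∀ xs →
               countᵇ p xs ≡ countᵇ (λ x → q x ∧ p x) xs + countᵇ (λ x → not (q x) ∧ p x) xs
countᵇ-split q p xs = begin
  countᵇ p xs
    ≡⟨ countᵇ-as-∑ p xs ⟩
  ∑ xs (indicator ∘ p)
    ≡⟨ ∑-cong (λ x → indicator-split (q x) (p x)) xs ⟩
  ∑ xs (λ x → indicator (q x ∧ p x) + indicator (not (q x) ∧ p x))
    ≡⟨ ∑-+ _ _ xs ⟩
  ∑ xs (λ x → indicator (q x ∧ p x)) + ∑ xs (λ x → indicator (not (q x) ∧ p x))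
    ≡⟨ cong₂ _+_ (countᵇ-as-∑ _ xs) (countᵇ-as-∑ _ xs) ⟨
  countᵇ (λ x → q x ∧ p x) xs + countᵇ (λ x → not (q x) ∧ p x) xs
    ∎
  where open ≡-Reasoning

countᵇ-cartesianProduct : (p : A × B → Bool) → ∀ xs ys →
                          countᵇ p (cartesianProduct xs ys) ≡ ∑ xs (λ x → countᵇ (λ y → p (x , y)) ys)
countᵇ-cartesianProduct p xs ys = begin
  countᵇ p (cartesianProduct xs ys)                        ≡⟨ countᵇ-as-∑ p (cartesianProduct xs ys) ⟩
  ∑ (cartesianProduct xs ys) (indicator ∘ p)               ≡⟨ ∑-cartesianProduct _ xs ys ⟩
  ∑ xs (λ x → ∑ ys (λ y → indicator (p (x , y))))          ≡⟨ ∑-cong (λ x → countᵇ-as-∑ _ ys) xs ⟨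
  ∑ xs (λ x → countᵇ (λ y → p (x , y)) ys)                 ∎
  where open ≡-Reasoning

countᵇ-union-bound : (p : A → Bool) (q : B → A → Bool) (bs : List B) → ∀ xs →
                     (∀ x → p x ≡ true → ∃[ b ] b ∈ bs × q b x ≡ true) →
                     countᵇ p xs ≤ ∑ bs (λ b → countᵇ (q b) xs)
countᵇ-union-bound p q bs xs covered = begin
  countᵇ p xs                                     ≡⟨ countᵇ-as-∑ p xs ⟩
  ∑ xs (indicator ∘ p)                            ≤⟨ ∑-mono covered-once xs ⟩
  ∑ xs (λ x → ∑ bs (λ b → indicator (q b x)))     ≡⟨ ∑-swap _ xs bs ⟩
  ∑ bs (λ b → ∑ xs (indicator ∘ q b))             ≡⟨ ∑-cong (λ b → countᵇ-as-∑ (q b) xs) bs ⟨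
  ∑ bs (λ b → countᵇ (q b) xs)                    ∎
  where
  open ≤-Reasoning
  covered-once : ∀ x → indicator (p x) ≤ ∑ bs (λ b → indicator (q b x))
  covered-once x with p x in px
  ... | false = z≤n
  ... | true  with covered x px
  ...   | b , b∈bs , qbx = subst (λ c → indicator c ≤ ∑ bs (λ b → indicator (q b x))) qbx (∈⇒≤∑ (λ b → indicator (q b x)) b∈bs)

allᵇ-++ : (p : A → Bool) → ∀ xs ys → allᵇ p (xs ++ ys) ≡ allᵇ p xs ∧ allᵇ p ys
allᵇ-++ p []       ys = refl
allᵇ-++ p (x ∷ xs) ys = trans (cong (p x ∧_) (allᵇ-++ p xs ys)) (sym (∧-assoc (p x) (allᵇ p xs) (allᵇ p ys)))

allᵇ-map : (p : B → Bool) (f : A → B) → ∀ xs → allᵇ p (map f xs) ≡ allᵇ (p ∘ f) xs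
allᵇ-map p f []       = refl
allᵇ-map p f (x ∷ xs) = cong (p (f x) ∧_) (allᵇ-map p f xs)

-- Symmetric difference of graphs

_⊕_ : Graph n → Graph n → Graph n
_⊕_ {zero}  _       _       = tt
_⊕_ {suc n} (h , w) (g , v) = h ⊕ g , zipWith _xor_ w v

adj-⊕ : (H G : Graph n) → ∀ i j → adj (H ⊕ G) i j ≡ adj H i j xor adj G i j
adj-⊕ {suc n} (h , w) (g , v) zero    zero    = refl
adj-⊕ {suc n} (h , w) (g , v) zero    (suc j) = lookup-zipWith _xor_ j w v
adj-⊕ {suc n} (h , w) (g , v) (suc i) zero    = lookup-zipWith _xor_ i w v
adj-⊕ {suc n} (h , w) (g , v) (suc i) (suc j) = adj-⊕ h g i j

adj-irrefl : (G : Graph n) → ∀ i → adj G i i ≡ false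
adj-irrefl {suc n} (g , v) zero    = refl
adj-irrefl {suc n} (g , v) (suc i) = adj-irrefl g i

∑-allVec-suc : (f : Vec Bool (suc n) → ℕ) → ∑ (allVec (suc n)) f ≡ ∑ (allVec n) (λ v → f (true ∷ v) + f (false ∷ v))
∑-allVec-suc {n} f = trans (∑-concatMap f _ (allVec n)) (∑-cong (λ v → cong (f (true ∷ v) +_) (+-identityʳ _)) (allVec n))

∑-allVec-xor : (w : Vec Bool n) (f : Vec Bool n → ℕ) → ∑ (allVec n) f ≡ ∑ (allVec n) (f ∘ zipWith _xor_ w)
∑-allVec-xor []      f = refl
∑-allVec-xor {suc n} (c ∷ w) f = begin
  ∑ (allVec (suc n)) f                                                        ≡⟨ ∑-allVec-suc f ⟩
  ∑ (allVec n) (λ v → f (true ∷ v) + f (false ∷ v))                            ≡⟨ ∑-allVec-xor w _ ⟩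
  ∑ (allVec n) (λ v → f (true ∷ zipWith _xor_ w v) + f (false ∷ zipWith _xor_ w v)) ≡⟨ ∑-cong (first-bit c) (allVec n) ⟩
  ∑ (allVec n) (λ v → f ((c xor true) ∷ zipWith _xor_ w v) + f ((c xor false) ∷ zipWith _xor_ w v)) ≡⟨ ∑-allVec-suc (f ∘ zipWith _xor_ (c ∷ w)) ⟨
  ∑ (allVec (suc n)) (f ∘ zipWith _xor_ (c ∷ w))                               ∎
  where
  open ≡-Reasoning
  first-bit : ∀ c v → f (true ∷ zipWith _xor_ w v) + f (false ∷ zipWith _xor_ w v)
                    ≡ f ((c xor true) ∷ zipWith _xor_ w v) + f ((c xor false) ∷ zipWith _xor_ w v)
  first-bit false v = refl
  first-bit true  v = +-comm (f (true ∷ zipWith _xor_ w v)) _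

∑-allGraphs-⊕ : (H : Graph n) (f : Graph n → ℕ) → ∑ (allGraphs n) f ≡ ∑ (allGraphs n) (f ∘ (H ⊕_))
∑-allGraphs-⊕ {zero}  H       f = refl
∑-allGraphs-⊕ {suc n} (h , w) f = begin
  ∑ (allGraphs (suc n)) f                                                   ≡⟨ ∑-cartesianProduct f (allGraphs n) (allVec n) ⟩
  ∑ (allGraphs n) (λ g → ∑ (allVec n) (λ v → f (g , v)))                    ≡⟨ ∑-allGraphs-⊕ h _ ⟩
  ∑ (allGraphs n) (λ g → ∑ (allVec n) (λ v → f (h ⊕ g , v)))                ≡⟨ ∑-cong (λ g → ∑-allVec-xor w _) (allGraphs n) ⟩
  ∑ (allGraphs n) (λ g → ∑ (allVec n) (λ v → f (h ⊕ g , zipWith _xor_ w v))) ≡⟨ ∑-cartesianProduct _ (allGraphs n) (allVec n) ⟨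
  ∑ (allGraphs (suc n)) (f ∘ ((h , w) ⊕_))                                  ∎
  where open ≡-Reasoning

countᵇ-allGraphs-⊕ : (H : Graph n) (p : Graph n → Bool) → countᵇ p (allGraphs n) ≡ countᵇ (p ∘ (H ⊕_)) (allGraphs n)
countᵇ-allGraphs-⊕ {n} H p = begin
  countᵇ p (allGraphs n)                   ≡⟨ countᵇ-as-∑ p (allGraphs n) ⟩
  ∑ (allGraphs n) (indicator ∘ p)          ≡⟨ ∑-allGraphs-⊕ H _ ⟩
  ∑ (allGraphs n) (indicator ∘ p ∘ (H ⊕_)) ≡⟨ countᵇ-as-∑ (p ∘ (H ⊕_)) (allGraphs n) ⟨
  countᵇ (p ∘ (H ⊕_)) (allGraphs n)        ∎
  where open ≡-Reasoning

fromAdjacency : (Fin n → Fin n → Bool) → Graph n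
fromAdjacency {zero}  f = tt
fromAdjacency {suc n} f = fromAdjacency (λ i j → f (suc i) (suc j)) , Vec.tabulate (f zero ∘ suc)

adj-fromAdjacency : (f : Fin n → Fin n → Bool) → (∀ i j → f i j ≡ f j i) →
                    ∀ {i j} → i ≢ j → adj (fromAdjacency f) i j ≡ f i j
adj-fromAdjacency {suc n} f f-sym {zero}  {zero}  i≢j = ⊥-elim (i≢j refl)
adj-fromAdjacency {suc n} f f-sym {zero}  {suc j} i≢j = lookup∘tabulate (f zero ∘ suc) j
adj-fromAdjacency {suc n} f f-sym {suc i} {zero}  i≢j = trans (lookup∘tabulate (f zero ∘ suc) i) (f-sym zero (suc i))
adj-fromAdjacency {suc n} f f-sym {suc i} {suc j} i≢j =
  adj-fromAdjacency (λ i j → f (suc i) (suc j)) (λ i j → f-sym (suc i) (suc j)) (i≢j ∘ cong suc)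

Edge : ℕ → Set
Edge n = Fin n × Fin n

DistinctEdges : Edge n → Edge n → Set
DistinctEdges e e′ = e′ ≢ e × e′ ≢ swap e

isEdge : Edge n → Fin n → Fin n → Bool
isEdge (x , y) a b = (does (a ≟ x) ∧ does (b ≟ y)) ∨ (does (a ≟ y) ∧ does (b ≟ x))

isEdge-sym : (e : Edge n) → ∀ a b → isEdge e a b ≡ isEdge e b a
isEdge-sym (x , y) a b = trans (∨-comm (does (a ≟ x) ∧ does (b ≟ y)) _)
  (cong₂ _∨_ (∧-comm (does (a ≟ y)) (does (b ≟ x))) (∧-comm (does (a ≟ x)) (does (b ≟ y))))

does-≟-pair : ∀ {a b x y : Fin n} → (a , b) ≢ (x , y) → (does (a ≟ x) ∧ does (b ≟ y)) ≡ false
does-≟-pair {a = a} {b} {x} {y} ab≢xy with a ≟ x | b ≟ y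
... | yes refl | yes refl = ⊥-elim (ab≢xy refl)
... | yes _    | no _     = refl
... | no _     | _        = refl

edgeGraph : Edge n → Graph n
edgeGraph e = fromAdjacency (isEdge e)

adj-edgeGraph : ∀ {x y : Fin n} → x ≢ y → adj (edgeGraph (x , y)) x y ≡ true
adj-edgeGraph {x = x} {y} x≢y = begin
  adj (edgeGraph (x , y)) x y ≡⟨ adj-fromAdjacency (isEdge (x , y)) (isEdge-sym (x , y)) x≢y ⟩
  isEdge (x , y) x y          ≡⟨ cong₂ (λ a b → (a ∧ b) ∨ (does (x ≟ y) ∧ does (y ≟ x))) (dec-true (x ≟ x) refl) (dec-true (y ≟ y) refl) ⟩
  true                        ∎
  where open ≡-Reasoning

adj-edgeGraph-distinct : (e : Edge n) → ∀ {a b} → DistinctEdges e (a , b) → adj (edgeGraph e) a b ≡ false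
adj-edgeGraph-distinct e {a} {b} (≢e , ≢swap-e) with a ≟ b
... | yes refl = adj-irrefl (edgeGraph e) a
... | no a≢b   = trans (adj-fromAdjacency (isEdge e) (isEdge-sym e) a≢b) (cong₂ _∨_ (does-≟-pair ≢e) (does-≟-pair ≢swap-e))

-- Independent edge constraints

Constraint : ℕ → Set
Constraint n = Edge n × Bool

satisfies : Graph n → Constraint n → Bool
satisfies G ((x , y) , b) = beq b (adj G x y)

satisfiesAll : Graph n → List (Constraint n) → Bool
satisfiesAll G cs = allᵇ (satisfies G) cs

Independent : List (Constraint n) → Set
Independent cs = All (λ ((x , y) , _) → x ≢ y) cs × AllPairs (λ c c′ → DistinctEdges (proj₁ c) (proj₁ c′)) cs

beq-not : ∀ b a → beq b (not a) ≡ not (beq b a)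
beq-not true  a = refl
beq-not false a = refl

satisfies-⊕-flip : (H G : Graph n) {x y : Fin n} (b : Bool) → adj H x y ≡ true →
                   satisfies (H ⊕ G) ((x , y) , b) ≡ not (satisfies G ((x , y) , b))
satisfies-⊕-flip H G {x} {y} b Hxy rewrite adj-⊕ H G x y | Hxy = beq-not b (adj G x y)

satisfiesAll-⊕-stable : (H G : Graph n) (cs : List (Constraint n)) → All (λ ((x , y) , _) → adj H x y ≡ false) cs →
                        satisfiesAll (H ⊕ G) cs ≡ satisfiesAll G cs
satisfiesAll-⊕-stable H G []                    []          = refl
satisfiesAll-⊕-stable H G (((x , y) , b) ∷ cs) (Hxy ∷ Hcs) rewrite adj-⊕ H G x y | Hxy =
  cong (satisfies G ((x , y) , b) ∧_) (satisfiesAll-⊕-stable H G cs Hcs)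

-- Toggling the edge xy is a bijection of graphs that flips the new constraint and fixes the others.
countᵇ-satisfiesAll-∷ : {x y : Fin n} (b : Bool) (cs : List (Constraint n)) → x ≢ y →
                        All (λ c → DistinctEdges (x , y) (proj₁ c)) cs →
                        countᵇ (λ G → satisfiesAll G cs) (allGraphs n)
                          ≡ 2 * countᵇ (λ G → satisfiesAll G (((x , y) , b) ∷ cs)) (allGraphs n)
countᵇ-satisfiesAll-∷ {n} {x} {y} b cs x≢y distinct = begin
  countᵇ (λ G → satisfiesAll G cs) graphs                      ≡⟨ countᵇ-split (λ G → satisfies G c) _ graphs ⟩
  countᵇ agreeing graphs + countᵇ disagreeing graphs          ≡⟨ cong (countᵇ agreeing graphs +_) toggled ⟩
  countᵇ agreeing graphs + countᵇ agreeing graphs             ≡⟨ cong (countᵇ agreeing graphs +_) (+-identityʳ _) ⟨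
  2 * countᵇ agreeing graphs                                  ∎
  where
  open ≡-Reasoning
  graphs = allGraphs n
  c = ((x , y) , b)
  E = edgeGraph (x , y)
  agreeing disagreeing : Graph n → Bool
  agreeing G    = satisfies G c ∧ satisfiesAll G cs
  disagreeing G = not (satisfies G c) ∧ satisfiesAll G cs
  toggled : countᵇ disagreeing graphs ≡ countᵇ agreeing graphs
  toggled = trans (countᵇ-allGraphs-⊕ E disagreeing) (countᵇ-cong (λ G → cong₂ _∧_
    (trans (cong not (satisfies-⊕-flip E G b (adj-edgeGraph x≢y))) (not-involutive (satisfies G c)))
    (satisfiesAll-⊕-stable E G cs (All.map (adj-edgeGraph-distinct (x , y)) distinct))) graphs)

countᵇ-satisfiesAll : (cs : List (Constraint n)) → Independent cs →
                      countᵇ (λ G → satisfiesAll G cs) (allGraphs n) * 2 ^ length cs ≡ length (allGraphs n)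
countᵇ-satisfiesAll {n} []                   _ = trans (*-identityʳ _) (countᵇ-true (allGraphs n))
countᵇ-satisfiesAll {n} (((x , y) , b) ∷ cs) (x≢y ∷ loopless , distinct ∷ pairwise) = begin
  count (c ∷ cs) * (2 * 2 ^ length cs)    ≡⟨ *-assoc (count (c ∷ cs)) 2 _ ⟨
  count (c ∷ cs) * 2 * 2 ^ length cs      ≡⟨ cong (_* 2 ^ length cs) (*-comm (count (c ∷ cs)) 2) ⟩
  2 * count (c ∷ cs) * 2 ^ length cs      ≡⟨ cong (_* 2 ^ length cs) (countᵇ-satisfiesAll-∷ b cs x≢y distinct) ⟨
  count cs * 2 ^ length cs                ≡⟨ countᵇ-satisfiesAll cs (loopless , pairwise) ⟩
  length (allGraphs n)                    ∎
  where
  open ≡-Reasoning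
  c = ((x , y) , b)
  count : List (Constraint n) → ℕ
  count cs = countᵇ (λ G → satisfiesAll G cs) (allGraphs n)

-- Running time of Greedy

if-elim : (P : A → Set) (b : Bool) {x y : A} → (b ≡ true → P x) → (b ≡ false → P y) → P (if b then x else y)
if-elim P true  onTrue onFalse = onTrue refl
if-elim P false onTrue onFalse = onFalse refl

-- one step of bookkeeping and two checks, each costing checkCost = |S₁| + 1
attemptCost : ℕ → ℕ
attemptCost s = suc (suc s + suc s)

module Iteration (G₁ G₂ : Graph n) (i : Fin n) where

  -- The local functions rest and second of tryJ (not accessible from outside Defs): continue with
  -- the remaining j's, resp. try the pair (u_j , v_i), after c₁ steps have been spent on j.
  continue : List (Fin n) → Matching n → ℕ → Matching n × ℕ
  continue js ps c₁ = proj₁ (tryJ G₁ G₂ i js ps) , suc (c₁ + proj₂ (tryJ G₁ G₂ i js ps))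

  tryBackward : Fin n → List (Fin n) → Matching n → ℕ → Matching n × ℕ
  tryBackward j js ps c₁ =
    if not (inS₁ j ps)
    then (if check G₁ G₂ j i ps
          then (((j , i) ∷ ps) , suc (c₁ + checkCost ps))
          else continue js ps (c₁ + checkCost ps))
    else continue js ps c₁

  CostWithin : List (Fin n) → Matching n → Matching n × ℕ → Set
  CostWithin js ps r = proj₂ r ≤ length js * attemptCost (length ps)

  mutual
    tryJ-cost : ∀ js ps → CostWithin js ps (tryJ G₁ G₂ i js ps)
    tryJ-cost []       ps = z≤n
    tryJ-cost (j ∷ js) ps =
      if-elim (CostWithin (j ∷ js) ps) (not (inS₂ j ps))
        (λ _ → if-elim (CostWithin (j ∷ js) ps) (check G₁ G₂ i j ps)
          (λ _ → s≤s (≤-trans (m≤m+n (checkCost ps) (checkCost ps)) (m≤m+n _ _)))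
          (λ _ → tryBackward-cost j js ps (checkCost ps) ≤-refl))
        (λ _ → tryBackward-cost j js ps 0 z≤n)

    tryBackward-cost : ∀ j js ps c₁ → c₁ ≤ checkCost ps → CostWithin (j ∷ js) ps (tryBackward j js ps c₁)
    tryBackward-cost j js ps c₁ c₁≤ =
      if-elim (CostWithin (j ∷ js) ps) (not (inS₁ j ps))
        (λ _ → if-elim (CostWithin (j ∷ js) ps) (check G₁ G₂ j i ps)
          (λ _ → s≤s (≤-trans (+-monoˡ-≤ (checkCost ps) c₁≤) (m≤m+n _ _)))
          (λ _ → s≤s (+-mono-≤ (+-monoˡ-≤ (checkCost ps) c₁≤) (tryJ-cost js ps))))
        (λ _ → s≤s (+-mono-≤ (≤-trans c₁≤ (m≤m+n _ _)) (tryJ-cost js ps)))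

  data Added (Q : Fin n → Set) (ps : Matching n) : Fin n × Fin n → Set where
    forward  : ∀ {j} → Q j → inS₂ j ps ≡ false → check G₁ G₂ i j ps ≡ true → Added Q ps (i , j)
    backward : ∀ {j} → Q j → check G₁ G₂ j i ps ≡ true → Added Q ps (j , i)

  data Outcome (Q : Fin n → Set) (ps : Matching n) : Matching n → Set where
    unchanged : Outcome Q ps ps
    extended  : ∀ {x} → Added Q ps x → Outcome Q ps (x ∷ ps)

  mutual
    tryJ-outcome : (Q : Fin n → Set) → ∀ js ps → All Q js → Outcome Q ps (proj₁ (tryJ G₁ G₂ i js ps))
    tryJ-outcome Q []       ps []         = unchanged
    tryJ-outcome Q (j ∷ js) ps (Qj ∷ Qjs) =
      if-elim (Outcome Q ps ∘ proj₁) (not (inS₂ j ps))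
        (λ j∉S₂ → if-elim (Outcome Q ps ∘ proj₁) (check G₁ G₂ i j ps)
          (λ ok → extended (forward Qj (not-injective j∉S₂) ok))
          (λ _ → tryBackward-outcome Q j js ps _ Qj Qjs))
        (λ _ → tryBackward-outcome Q j js ps _ Qj Qjs)

    tryBackward-outcome : (Q : Fin n → Set) → ∀ j js ps c₁ → Q j → All Q js →
                          Outcome Q ps (proj₁ (tryBackward j js ps c₁))
    tryBackward-outcome Q j js ps c₁ Qj Qjs =
      if-elim (Outcome Q ps ∘ proj₁) (not (inS₁ j ps))
        (λ _ → if-elim (Outcome Q ps ∘ proj₁) (check G₁ G₂ j i ps)
          (λ ok → extended (backward Qj ok))
          (λ _ → tryJ-outcome Q js ps Qjs))
        (λ _ → tryJ-outcome Q js ps Qjs)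

  outcome-length : ∀ {Q ps ps′} → Outcome Q ps ps′ → length ps ≤ length ps′ × length ps′ ≤ suc (length ps)
  outcome-length unchanged    = ≤-refl , n≤1+n _
  outcome-length (extended _) = n≤1+n _ , ≤-refl

  iteration-outcome : ∀ ps → Outcome (λ j → toℕ j ≤ toℕ i) ps (proj₁ (tryJ G₁ G₂ i (upToFin i) ps))
  iteration-outcome ps = tryJ-outcome _ (upToFin i) ps (All.all-filter (λ j → toℕ j ≤? toℕ i) (allFin n))

  iteration-cost : ∀ ps → proj₂ (tryJ G₁ G₂ i (upToFin i) ps) ≤ n * attemptCost (length ps)
  iteration-cost ps = ≤-trans (tryJ-cost (upToFin i) ps) (*-monoˡ-≤ _ length-upToFin)
    where
    length-upToFin : length (upToFin i) ≤ n
    length-upToFin = ≤-trans (length-filter (λ j → toℕ j ≤? toℕ i) (allFin n)) (≤-reflexive (length-tabulate id))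

attemptCost-mono : ∀ {s t} → s ≤ t → attemptCost s ≤ attemptCost t
attemptCost-mono s≤t = s≤s (+-mono-≤ (s≤s s≤t) (s≤s s≤t))

module Run (G₁ G₂ : Graph n) where
  open Iteration G₁ G₂

  -- greedyRun G₁ G₂ is definitionally foldl step ([] , 0) (allFin n).
  step : Matching n × ℕ → Fin n → Matching n × ℕ
  step acc i = proj₁ (tryJ G₁ G₂ i (upToFin i) (proj₁ acc)) , proj₂ acc + suc (proj₂ (tryJ G₁ G₂ i (upToFin i) (proj₁ acc)))

  size : Matching n × ℕ → ℕ
  size acc = length (proj₁ acc)

  step-size : ∀ acc i → size acc ≤ size (step acc i) × size (step acc i) ≤ suc (size acc)
  step-size acc i = outcome-length i (iteration-outcome i (proj₁ acc))

  run-size-mono : ∀ acc xs → size acc ≤ size (foldl step acc xs)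
  run-size-mono acc []       = ≤-refl
  run-size-mono acc (x ∷ xs) =
    ≤-trans (proj₁ (step-size acc x)) (run-size-mono (step acc x) xs)

  run-size-≤ : ∀ acc xs → size (foldl step acc xs) ≤ size acc + length xs
  run-size-≤ acc []       = m≤m+n _ 0
  run-size-≤ acc (x ∷ xs) = begin
    size (foldl step (step acc x) xs) ≤⟨ run-size-≤ (step acc x) xs ⟩
    size (step acc x) + length xs     ≤⟨ +-monoˡ-≤ (length xs) (proj₂ (step-size acc x)) ⟩
    suc (size acc) + length xs        ≡⟨ +-suc (size acc) (length xs) ⟨
    size acc + length (x ∷ xs)        ∎
    where open ≤-Reasoning

  run-time : ∀ acc xs → let final = foldl step acc xs in
             proj₂ final ≤ proj₂ acc + length xs * suc (n * attemptCost (size final))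
  run-time acc []       = m≤m+n _ 0
  run-time acc (x ∷ xs) = begin
    proj₂ final                                   ≤⟨ run-time (step acc x) xs ⟩
    proj₂ acc + suc (proj₂ (tryJ G₁ G₂ x (upToFin x) (proj₁ acc))) + length xs * K
                                                  ≤⟨ +-monoˡ-≤ (length xs * K) (+-monoʳ-≤ (proj₂ acc) (s≤s step-cost)) ⟩
    proj₂ acc + K + length xs * K                 ≡⟨ +-assoc (proj₂ acc) K (length xs * K) ⟩
    proj₂ acc + length (x ∷ xs) * K               ∎
    where
    open ≤-Reasoning
    final = foldl step (step acc x) xs
    K = suc (n * attemptCost (size final))
    step-cost : proj₂ (tryJ G₁ G₂ x (upToFin x) (proj₁ acc)) ≤ n * attemptCost (size final)
    step-cost = ≤-trans (iteration-cost x (proj₁ acc))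
      (*-monoʳ-≤ n (attemptCost-mono (≤-trans (proj₁ (step-size acc x)) (run-size-mono (step acc x) xs))))

greedyMatching-length : (G₁ G₂ : Graph n) → length (greedyMatching G₁ G₂) ≤ n
greedyMatching-length {n} G₁ G₂ = subst (length (greedyMatching G₁ G₂) ≤_) (length-tabulate {A = Fin n} id) (Run.run-size-≤ G₁ G₂ ([] , 0) (allFin n))

greedyTime-bound : (G₁ G₂ : Graph n) → greedyTime G₁ G₂ ≤ n * suc (n * attemptCost (length (greedyMatching G₁ G₂)))
greedyTime-bound {n} G₁ G₂ =
  subst (λ m → greedyTime G₁ G₂ ≤ m * suc (n * attemptCost (length (greedyMatching G₁ G₂))))
        (length-tabulate {A = Fin n} id) (Run.run-time G₁ G₂ ([] , 0) (allFin n))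

-- The output of Greedy is a consistent matching

-- Every pair passed Greedy's tests against the pairs added before it, i.e. the tail of the list.
consistent : Graph n → Graph n → Matching n → Bool
consistent G₁ G₂ []             = true
consistent G₁ G₂ ((a , b) ∷ ps) = not (inS₂ b ps) ∧ check G₁ G₂ a b ps ∧ consistent G₁ G₂ ps

Bounded : ℕ → Matching n → Set
Bounded k ps = All (λ (a , b) → toℕ a < k × toℕ b < k) ps

Bounded-suc : ∀ {k} {ps : Matching n} → Bounded k ps → Bounded (suc k) ps
Bounded-suc = All.map (λ (a<k , b<k) → m<n⇒m<1+n a<k , m<n⇒m<1+n b<k)

inS₂-Bounded : (v : Fin n) (ps : Matching n) → Bounded (toℕ v) ps → inS₂ v ps ≡ false
inS₂-Bounded v []       []                = refl
inS₂-Bounded v (p ∷ ps) ((_ , b<v) ∷ bnd) with proj₂ p ≟ v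
... | yes refl = ⊥-elim (<-irrefl refl b<v)
... | no _     = inS₂-Bounded v ps bnd

data Consecutive {n} : ℕ → List (Fin n) → Set where
  []  : ∀ {k} → Consecutive k []
  _∷_ : ∀ {k x xs} → toℕ x ≡ k → Consecutive (suc k) xs → Consecutive k (x ∷ xs)

tabulate-Consecutive : ∀ {m} k (f : Fin m → Fin n) → (∀ x → toℕ (f x) ≡ k + toℕ x) → Consecutive k (tabulate f)
tabulate-Consecutive {m = zero}  k f offset = []
tabulate-Consecutive {m = suc m} k f offset =
  trans (offset zero) (+-identityʳ k) ∷ tabulate-Consecutive (suc k) (f ∘ suc) (λ x → trans (offset (suc x)) (+-suc k (toℕ x)))

module Invariant (G₁ G₂ : Graph n) where
  open Iteration G₁ G₂
  open Run G₁ G₂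

  -- Before iteration i all matched vertices are < i; in particular v_i is still free for (u_j , v_i).
  outcome-invariant : ∀ i {ps ps′} → Outcome i (λ j → toℕ j ≤ toℕ i) ps ps′ →
                      Bounded (toℕ i) ps → consistent G₁ G₂ ps ≡ true →
                      Bounded (suc (toℕ i)) ps′ × consistent G₁ G₂ ps′ ≡ true
  outcome-invariant i unchanged bnd ok = Bounded-suc bnd , ok
  outcome-invariant i (extended (forward j≤i j∉S₂ check-ok)) bnd ok =
    (≤-refl , s≤s j≤i) ∷ Bounded-suc bnd , cong₂ _∧_ (cong not j∉S₂) (cong₂ _∧_ check-ok ok)
  outcome-invariant i {ps} (extended (backward j≤i check-ok)) bnd ok =
    (s≤s j≤i , ≤-refl) ∷ Bounded-suc bnd , cong₂ _∧_ (cong not (inS₂-Bounded i ps bnd)) (cong₂ _∧_ check-ok ok)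

  run-invariant : ∀ acc k xs → Consecutive k xs → Bounded k (proj₁ acc) → consistent G₁ G₂ (proj₁ acc) ≡ true →
                  consistent G₁ G₂ (proj₁ (foldl step acc xs)) ≡ true
  run-invariant acc k []       []            bnd ok = ok
  run-invariant acc k (x ∷ xs) (refl ∷ cons) bnd ok =
    let bnd′ , ok′ = outcome-invariant x (iteration-outcome x (proj₁ acc)) bnd ok in run-invariant (step acc x) (suc k) xs cons bnd′ ok′

greedyMatching-consistent : (G₁ G₂ : Graph n) → consistent G₁ G₂ (greedyMatching G₁ G₂) ≡ true
greedyMatching-consistent {n} G₁ G₂ =
  Invariant.run-invariant G₁ G₂ ([] , 0) 0 (allFin n) (tabulate-Consecutive 0 id (λ _ → refl)) [] refl

consistent-drop : (G₁ G₂ : Graph n) → ∀ k ps → consistent G₁ G₂ ps ≡ true → consistent G₁ G₂ (drop k ps) ≡ true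
consistent-drop G₁ G₂ zero    ps             ok = ok
consistent-drop G₁ G₂ (suc k) []             ok = ok
consistent-drop G₁ G₂ (suc k) ((a , b) ∷ ps) ok =
  consistent-drop G₁ G₂ k ps (∧-conicalʳ (check G₁ G₂ a b ps) _ (∧-conicalʳ (not (inS₂ b ps)) _ ok))

-- Consistent matchings are rare

inS₂-false : (v : Fin n) (ps : Matching n) → inS₂ v ps ≡ false → All (λ q → v ≢ proj₂ q) ps
inS₂-false v []       _   = []
inS₂-false v (q ∷ ps) v∉ with proj₂ q ≟ v
inS₂-false v (q ∷ ps) () | yes _
inS₂-false v (q ∷ ps) v∉ | no q₂≢v = (q₂≢v ∘ sym) ∷ inS₂-false v ps v∉

-- The check made when (a , b) was added to ps, read as constraints on the edges of G₂ at b.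
edgeConstraints : Graph n → Fin n → Fin n → Matching n → List (Constraint n)
edgeConstraints G₁ a b ps = map (λ (a′ , b′) → (b , b′) , adj G₁ a a′) ps

constraints : Graph n → Matching n → List (Constraint n)
constraints G₁ []             = []
constraints G₁ ((a , b) ∷ ps) = edgeConstraints G₁ a b ps ++ constraints G₁ ps

length-constraints : (G₁ : Graph n) (σ : Matching n) → length (constraints G₁ σ) ≡ length σ C 2
length-constraints G₁ []             = refl
length-constraints G₁ ((a , b) ∷ ps) = begin
  length (edgeConstraints G₁ a b ps ++ constraints G₁ ps)          ≡⟨ length-++ (edgeConstraints G₁ a b ps) ⟩
  length (edgeConstraints G₁ a b ps) + length (constraints G₁ ps)  ≡⟨ cong₂ _+_ (length-map _ ps) (length-constraints G₁ ps) ⟩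
  length ps + length ps C 2                                        ≡⟨ cong (_+ length ps C 2) (nC1≡n (length ps)) ⟨
  length ps C 1 + length ps C 2                                    ≡⟨ nCk+nC[k+1]≡[n+1]C[k+1] (length ps) 1 ⟩
  suc (length ps) C 2                                              ∎
  where open ≡-Reasoning

consistent⇒satisfiesAll : (G₁ G₂ : Graph n) (σ : Matching n) → consistent G₁ G₂ σ ≡ true →
                          satisfiesAll G₂ (constraints G₁ σ) ≡ true
consistent⇒satisfiesAll G₁ G₂ []             _  = refl
consistent⇒satisfiesAll G₁ G₂ ((a , b) ∷ ps) ok = begin
  satisfiesAll G₂ (edgeConstraints G₁ a b ps ++ constraints G₁ ps)
    ≡⟨ allᵇ-++ (satisfies G₂) (edgeConstraints G₁ a b ps) (constraints G₁ ps) ⟩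
  satisfiesAll G₂ (edgeConstraints G₁ a b ps) ∧ satisfiesAll G₂ (constraints G₁ ps)
    ≡⟨ cong₂ _∧_ (trans (allᵇ-map (satisfies G₂) _ ps) (∧-conicalˡ _ _ checked))
                 (consistent⇒satisfiesAll G₁ G₂ ps (∧-conicalʳ _ _ checked)) ⟩
  true
    ∎
  where
  open ≡-Reasoning
  checked : check G₁ G₂ a b ps ∧ consistent G₁ G₂ ps ≡ true
  checked = ∧-conicalʳ (not (inS₂ b ps)) _ ok

SecondsDistinct : Matching n → Set
SecondsDistinct = AllPairs (λ p q → proj₂ p ≢ proj₂ q)

consistent⇒SecondsDistinct : (G₁ G₂ : Graph n) (σ : Matching n) → consistent G₁ G₂ σ ≡ true → SecondsDistinct σ
consistent⇒SecondsDistinct G₁ G₂ []             _  = []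
consistent⇒SecondsDistinct G₁ G₂ ((a , b) ∷ ps) ok =
  inS₂-false b ps (not-injective (∧-conicalˡ _ _ ok))
  ∷ consistent⇒SecondsDistinct G₁ G₂ ps (∧-conicalʳ _ _ (∧-conicalʳ (not (inS₂ b ps)) _ ok))

constraints-avoid : (G₁ : Graph n) {v : Fin n} (ps : Matching n) → All (λ q → v ≢ proj₂ q) ps →
                    All (λ ((x , y) , _) → v ≢ x × v ≢ y) (constraints G₁ ps)
constraints-avoid G₁ []             []            = []
constraints-avoid G₁ ((a , b) ∷ ps) (v≢b ∷ v∉ps) =
  All.++⁺ (All.map⁺ (All.map (v≢b ,_) v∉ps)) (constraints-avoid G₁ ps v∉ps)

edgeConstraints-pairwise : {b : Fin n} (ps : Matching n) → All (λ q → b ≢ proj₂ q) ps → SecondsDistinct ps →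
                           AllPairs (λ q q′ → DistinctEdges (b , proj₂ q) (b , proj₂ q′)) ps
edgeConstraints-pairwise []       []           []                = []
edgeConstraints-pairwise (q ∷ ps) (b≢q ∷ b∉ps) (q∉ps ∷ distinct) =
  All.map (λ q≢q′ → (λ e → q≢q′ (sym (cong proj₂ e))) , (λ e → b≢q (cong proj₁ e))) q∉ps
  ∷ edgeConstraints-pairwise ps b∉ps distinct

constraints-Independent : (G₁ : Graph n) (σ : Matching n) → SecondsDistinct σ → Independent (constraints G₁ σ)
constraints-Independent G₁ []             []                 = [] , []
constraints-Independent G₁ ((a , b) ∷ ps) (b∉ps ∷ distinct) =
  All.++⁺ (All.map⁺ b∉ps) loopless ,
  AllPairs.++⁺ (AllPairs.map⁺ (edgeConstraints-pairwise ps b∉ps distinct)) pairwise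
    (All.map⁺ (All.universal (λ q → All.map separated (constraints-avoid G₁ ps b∉ps)) ps))
  where
  loopless = proj₁ (constraints-Independent G₁ ps distinct)
  pairwise = proj₂ (constraints-Independent G₁ ps distinct)
  separated : ∀ {b′ x y} → b ≢ x × b ≢ y → DistinctEdges (b , b′) (x , y)
  separated (b≢x , b≢y) = (λ e → b≢x (sym (cong proj₁ e))) , (λ e → b≢y (sym (cong proj₂ e)))

countᵇ-consistent : (G₁ : Graph n) (σ : Matching n) →
                    countᵇ (λ G₂ → consistent G₁ G₂ σ) (allGraphs n) * 2 ^ (length σ C 2) ≤ length (allGraphs n)
countᵇ-consistent {n} G₁ σ with allPairs? (λ p q → ¬? (proj₂ p ≟ proj₂ q)) σ
... | yes distinct = begin
  countᵇ (λ G₂ → consistent G₁ G₂ σ) graphs * 2 ^ (length σ C 2)   ≤⟨ *-monoˡ-≤ _ (countᵇ-mono (λ G₂ → consistent⇒satisfiesAll G₁ G₂ σ) graphs) ⟩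
  countᵇ (λ G₂ → satisfiesAll G₂ cs) graphs * 2 ^ (length σ C 2)   ≡⟨ cong (λ m → countᵇ (λ G₂ → satisfiesAll G₂ cs) graphs * 2 ^ m) (length-constraints G₁ σ) ⟨
  countᵇ (λ G₂ → satisfiesAll G₂ cs) graphs * 2 ^ length cs        ≡⟨ countᵇ-satisfiesAll cs (constraints-Independent G₁ σ distinct) ⟩
  length graphs                                                    ∎
  where
  open ≤-Reasoning
  graphs = allGraphs n
  cs = constraints G₁ σ
... | no indistinct = begin
  countᵇ (λ G₂ → consistent G₁ G₂ σ) graphs * 2 ^ (length σ C 2)   ≤⟨ *-monoˡ-≤ _ (countᵇ-mono impossible graphs) ⟩
  countᵇ (λ _ → false) graphs * 2 ^ (length σ C 2)                 ≡⟨ cong (_* 2 ^ (length σ C 2)) (countᵇ-false graphs) ⟩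
  0                                                                ≤⟨ z≤n ⟩
  length graphs                                                    ∎
  where
  open ≤-Reasoning
  graphs = allGraphs n
  impossible : ∀ G₂ → consistent G₁ G₂ σ ≡ true → false ≡ true
  impossible G₂ ok = ⊥-elim (indistinct (consistent⇒SecondsDistinct G₁ G₂ σ ok))

countᵇ-consistent-pairs : (σ : Matching n) →
                          countᵇ (λ (G₁ , G₂) → consistent G₁ G₂ σ) (allPairs n) * 2 ^ (length σ C 2) ≤ totalCount n
countᵇ-consistent-pairs {n} σ = begin
  countᵇ (λ (G₁ , G₂) → consistent G₁ G₂ σ) (allPairs n) * 2 ^ (length σ C 2)
    ≡⟨ cong (_* 2 ^ (length σ C 2)) (countᵇ-cartesianProduct _ graphs graphs) ⟩
  ∑ graphs (λ G₁ → countᵇ (λ G₂ → consistent G₁ G₂ σ) graphs) * 2 ^ (length σ C 2)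
    ≤⟨ ∑-*-bounded _ _ _ graphs (λ {G₁} _ → countᵇ-consistent G₁ σ) ⟩
  length graphs * length graphs
    ≡⟨ length-cartesianProductWith _,_ graphs graphs ⟨
  totalCount n
    ∎
  where
  open ≤-Reasoning
  graphs = allGraphs n

matchingsOfLength : ∀ n → ℕ → List (Matching n)
matchingsOfLength n zero    = [] ∷ []
matchingsOfLength n (suc m) = cartesianProductWith _∷_ (cartesianProduct (allFin n) (allFin n)) (matchingsOfLength n m)

length-matchingsOfLength : ∀ n m → length (matchingsOfLength n m) ≡ (n * n) ^ m
length-matchingsOfLength n zero    = refl
length-matchingsOfLength n (suc m) = begin
  length (cartesianProductWith _∷_ (cartesianProduct (allFin n) (allFin n)) (matchingsOfLength n m))
    ≡⟨ length-cartesianProductWith _∷_ (cartesianProduct (allFin n) (allFin n)) (matchingsOfLength n m) ⟩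
  length (cartesianProduct (allFin n) (allFin n)) * length (matchingsOfLength n m)
    ≡⟨ cong₂ _*_ (length-cartesianProductWith _,_ (allFin n) (allFin n)) (length-matchingsOfLength n m) ⟩
  length (allFin n) * length (allFin n) * (n * n) ^ m
    ≡⟨ cong (λ k → k * k * (n * n) ^ m) (length-tabulate {A = Fin n} id) ⟩
  n * n * (n * n) ^ m
    ∎
  where open ≡-Reasoning

∈-matchingsOfLength⁺ : (σ : Matching n) → σ ∈ matchingsOfLength n (length σ)
∈-matchingsOfLength⁺ []             = here refl
∈-matchingsOfLength⁺ ((a , b) ∷ σ) =
  ∈-cartesianProductWith⁺ _∷_ (∈-cartesianProduct⁺ (∈-allFin a) (∈-allFin b)) (∈-matchingsOfLength⁺ σ)

∈-matchingsOfLength⁻ : ∀ m {σ : Matching n} → σ ∈ matchingsOfLength n m → length σ ≡ m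
∈-matchingsOfLength⁻ zero    (here refl) = refl
∈-matchingsOfLength⁻ {n} (suc m) σ∈ with ∈-cartesianProductWith⁻ _∷_ (cartesianProduct (allFin n) (allFin n)) (matchingsOfLength n m) σ∈
... | _ , _ , _ , τ∈ , refl = cong suc (∈-matchingsOfLength⁻ m τ∈)

-- A slow run has at least m pairs, and the first m of them (a suffix of the list) form a consistent
-- matching of length m.
badCount-bound : ∀ n m bound → (∀ (G₁ G₂ : Graph n) → length (greedyMatching G₁ G₂) < m → greedyTime G₁ G₂ ≤ bound) →
                 badCount n bound * 2 ^ (m C 2) ≤ (n * n) ^ m * totalCount n
badCount-bound n m bound fast-if-short = begin
  badCount n bound * 2 ^ (m C 2)
    ≤⟨ *-monoˡ-≤ _ (countᵇ-union-bound _ (λ σ (G₁ , G₂) → consistent G₁ G₂ σ) matchings (allPairs n) witness) ⟩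
  ∑ matchings (λ σ → countᵇ (λ (G₁ , G₂) → consistent G₁ G₂ σ) (allPairs n)) * 2 ^ (m C 2)
    ≤⟨ ∑-*-bounded _ _ _ matchings (λ {σ} σ∈ → subst (λ l → countᵇ _ (allPairs n) * 2 ^ (l C 2) ≤ totalCount n)
                                                      (∈-matchingsOfLength⁻ m σ∈) (countᵇ-consistent-pairs σ)) ⟩
  length matchings * totalCount n
    ≡⟨ cong (_* totalCount n) (length-matchingsOfLength n m) ⟩
  (n * n) ^ m * totalCount n
    ∎
  where
  open ≤-Reasoning
  matchings = matchingsOfLength n m
  witness : ∀ ((G₁ , G₂) : Graph n × Graph n) → not (greedyTime G₁ G₂ ≤ᵇ bound) ≡ true →
            ∃[ σ ] σ ∈ matchings × consistent G₁ G₂ σ ≡ true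
  witness (G₁ , G₂) slow with m ≤? length (greedyMatching G₁ G₂)
  ... | yes m≤len = σ , subst (λ l → σ ∈ matchingsOfLength n l) length-σ (∈-matchingsOfLength⁺ σ)
                      , consistent-drop G₁ G₂ (len ∸ m) S (greedyMatching-consistent G₁ G₂)
    where
    S = greedyMatching G₁ G₂
    len = length S
    σ = drop (len ∸ m) S
    length-σ : length σ ≡ m
    length-σ = trans (length-drop (len ∸ m) S) (m∸[m∸n]≡n m≤len)
  ... | no m≰len = ⊥-elim (subst T (not-injective slow) (≤⇒≤ᵇ (fast-if-short G₁ G₂ (≰⇒> m≰len))))

n<2^[1+⌊log₂n⌋] : ∀ n → n < 2 ^ suc ⌊log₂ n ⌋
n<2^[1+⌊log₂n⌋] n with 2 ^ suc ⌊log₂ n ⌋ ≤? n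
... | no  2^≰n = ≰⇒> 2^≰n
... | yes 2^≤n = ⊥-elim (<-irrefl refl (subst (_≤ ⌊log₂ n ⌋) (⌊log₂[2^n]⌋≡n (suc ⌊log₂ n ⌋)) (⌊log₂⌋-mono-≤ 2^≤n)))

2^k≤n⇒k≤⌊log₂n⌋ : ∀ k n → 2 ^ k ≤ n → k ≤ ⌊log₂ n ⌋
2^k≤n⇒k≤⌊log₂n⌋ k n 2^k≤n = subst (_≤ ⌊log₂ n ⌋) (⌊log₂[2^n]⌋≡n k) (⌊log₂⌋-mono-≤ 2^k≤n)

n<2^n : ∀ n → n < 2 ^ n
n<2^n zero    = s≤s z≤n
n<2^n (suc n) = begin-strict
  suc n          ≤⟨ n<2^n n ⟩
  2 ^ n          <⟨ m<m+n (2 ^ n) (m^n>0 2 n) ⟩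
  2 ^ n + 2 ^ n  ≡⟨ cong (2 ^ n +_) (+-identityʳ (2 ^ n)) ⟨
  2 ^ suc n      ∎
  where open ≤-Reasoning

2*[nC2]+n≡n*n : ∀ n → 2 * (n C 2) + n ≡ n * n
2*[nC2]+n≡n*n zero    = refl
2*[nC2]+n≡n*n (suc n) = begin
  2 * (suc n C 2) + suc n             ≡⟨ cong (λ c → 2 * c + suc n) (nCk+nC[k+1]≡[n+1]C[k+1] n 1) ⟨
  2 * (n C 1 + n C 2) + suc n         ≡⟨ cong (λ c → 2 * (c + n C 2) + suc n) (nC1≡n n) ⟩
  2 * (n + n C 2) + suc n             ≡⟨ rearrange n (n C 2) ⟩
  (2 * (n C 2) + n) + (2 * n + 1)     ≡⟨ cong (_+ (2 * n + 1)) (2*[nC2]+n≡n*n n) ⟩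
  n * n + (2 * n + 1)                 ≡⟨ square-suc n ⟩
  suc n * suc n                       ∎
  where
  open ≡-Reasoning
  rearrange : ∀ n c → 2 * (n + c) + suc n ≡ (2 * c + n) + (2 * n + 1)
  rearrange = solve-∀
  square-suc : ∀ n → n * n + (2 * n + 1) ≡ suc n * suc n
  square-suc = solve-∀

cubic-bound : ∀ n → n * suc (n * attemptCost n) ≤ 6 * n ^ 3
cubic-bound zero    = z≤n
cubic-bound (suc m) = m+n≤o⇒m≤o _ (≤-reflexive (expand m))
  where
  expand : ∀ m → suc m * suc (suc m * suc (suc (suc m) + suc (suc m))) + (4 * (m * m * m) + 9 * (m * m) + 5 * m)
                 ≡ 6 * (suc m * (suc m * (suc m * 1)))
  expand = solve-∀

short-run-bound : ∀ n L → 1 ≤ n → 1 ≤ L → n * suc (n * attemptCost (8 * L + 7)) ≤ 34 * (n ^ 2 * L)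
short-run-bound (suc a) (suc b) _ _ = m+n≤o⇒m≤o _ (≤-reflexive (expand a b))
  where
  expand : ∀ a b → suc a * suc (suc a * suc (suc (8 * suc b + 7) + suc (8 * suc b + 7))) + (18 * b * (suc a * suc a) + a * suc a)
                   ≡ 34 * (suc a * (suc a * 1) * suc b)
  expand = solve-∀

-- Writing t = 1 + ⌊log₂ n⌋: n² < 4^t and k + 1 < 2^t, while 16t² + t ≤ (8t choose 2).
[1+k][n²]^m≤2^[mC2] : ∀ k n → suc k ≤ ⌊log₂ n ⌋ → suc k * (n * n) ^ (8 * suc ⌊log₂ n ⌋) ≤ 2 ^ (8 * suc ⌊log₂ n ⌋ C 2)
[1+k][n²]^m≤2^[mC2] k n k<log = begin
  suc k * (n * n) ^ (8 * t)              ≤⟨ *-mono-≤ (<⇒≤ (≤-<-trans (≤-trans k<log (n≤1+n _)) (n<2^n t)))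
                                                      (^-monoˡ-≤ (8 * t) (*-mono-≤ (<⇒≤ n<2^t) (<⇒≤ n<2^t))) ⟩
  2 ^ t * (2 ^ t * 2 ^ t) ^ (8 * t)      ≡⟨ cong (λ x → 2 ^ t * x ^ (8 * t)) (^-distribˡ-+-* 2 t t) ⟨
  2 ^ t * (2 ^ (t + t)) ^ (8 * t)        ≡⟨ cong (2 ^ t *_) (^-*-assoc 2 (t + t) (8 * t)) ⟩
  2 ^ t * 2 ^ ((t + t) * (8 * t))       ≡⟨ ^-distribˡ-+-* 2 t ((t + t) * (8 * t)) ⟨
  2 ^ (t + (t + t) * (8 * t))            ≤⟨ ^-monoʳ-≤ 2 exponent-bound ⟩
  2 ^ (8 * t C 2)                        ∎
  where
  open ≤-Reasoning
  t = suc ⌊log₂ n ⌋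
  n<2^t = n<2^[1+⌊log₂n⌋] n
  exponent-bound : t + (t + t) * (8 * t) ≤ 8 * t C 2
  exponent-bound = *-cancelˡ-≤ 2 (+-cancelʳ-≤ (8 * t) _ _
    (m+n≤o⇒m≤o _ (≤-reflexive (trans (expand ⌊log₂ n ⌋) (sym (2*[nC2]+n≡n*n (8 * t)))))))
    where
    expand : ∀ c → 2 * (suc c + (suc c + suc c) * (8 * suc c)) + 8 * suc c + (32 * (c * c) + 54 * c + 22)
                   ≡ 8 * suc c * (8 * suc c)
    expand = solve-∀

greedyTime-cubic : (n : ℕ) (G₁ G₂ : Graph n) → greedyTime G₁ G₂ ≤ 6 * n ^ 3
greedyTime-cubic n G₁ G₂ = begin
  greedyTime G₁ G₂                                             ≤⟨ greedyTime-bound G₁ G₂ ⟩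
  n * suc (n * attemptCost (length (greedyMatching G₁ G₂)))   ≤⟨ *-monoʳ-≤ n (s≤s (*-monoʳ-≤ n (attemptCost-mono (greedyMatching-length G₁ G₂)))) ⟩
  n * suc (n * attemptCost n)                                  ≤⟨ cubic-bound n ⟩
  6 * n ^ 3                                                    ∎
  where open ≤-Reasoning

greedyTime-short : ∀ {n} L → 1 ≤ n → 1 ≤ L → (G₁ G₂ : Graph n) →
                   length (greedyMatching G₁ G₂) < 8 * suc L → greedyTime G₁ G₂ ≤ 34 * (n ^ 2 * L)
greedyTime-short {n} L 1≤n 1≤L G₁ G₂ short = begin
  greedyTime G₁ G₂                                             ≤⟨ greedyTime-bound G₁ G₂ ⟩
  n * suc (n * attemptCost (length (greedyMatching G₁ G₂)))   ≤⟨ *-monoʳ-≤ n (s≤s (*-monoʳ-≤ n (attemptCost-mono size≤))) ⟩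
  n * suc (n * attemptCost (8 * L + 7))                        ≤⟨ short-run-bound n L 1≤n 1≤L ⟩
  34 * (n ^ 2 * L)                                             ∎
  where
  open ≤-Reasoning
  size≤ : length (greedyMatching G₁ G₂) ≤ 8 * L + 7
  size≤ = ≤-pred (subst (length (greedyMatching G₁ G₂) <_) (trans (*-suc 8 L) (trans (+-comm 8 (8 * L)) (+-suc (8 * L) 7))) short)

slow-runs-rare : ∀ k n → 2 ^ suc k ≤ n → suc k * badCount n (34 * (n ^ 2 * ⌊log₂ n ⌋)) ≤ totalCount n
slow-runs-rare k n 2^[1+k]≤n = *-cancelʳ-≤ _ _ (2 ^ (m C 2)) {{m^n≢0 2 (m C 2)}} (begin
  suc k * bad * 2 ^ (m C 2)              ≡⟨ *-assoc (suc k) bad _ ⟩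
  suc k * (bad * 2 ^ (m C 2))            ≤⟨ *-monoʳ-≤ (suc k) (badCount-bound n m _ fast-if-short) ⟩
  suc k * ((n * n) ^ m * totalCount n)   ≡⟨ *-assoc (suc k) ((n * n) ^ m) (totalCount n) ⟨
  suc k * (n * n) ^ m * totalCount n     ≤⟨ *-monoˡ-≤ (totalCount n) ([1+k][n²]^m≤2^[mC2] k n k<log) ⟩
  2 ^ (m C 2) * totalCount n             ≡⟨ *-comm (2 ^ (m C 2)) (totalCount n) ⟩
  totalCount n * 2 ^ (m C 2)             ∎)
  where
  open ≤-Reasoning
  L = ⌊log₂ n ⌋
  m = 8 * suc L
  bad = badCount n (34 * (n ^ 2 * L))
  k<log : suc k ≤ L
  k<log = 2^k≤n⇒k≤⌊log₂n⌋ (suc k) n 2^[1+k]≤n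
  fast-if-short : ∀ (G₁ G₂ : Graph n) → length (greedyMatching G₁ G₂) < m → greedyTime G₁ G₂ ≤ 34 * (n ^ 2 * L)
  fast-if-short = greedyTime-short L (≤-trans (m^n>0 2 (suc k)) 2^[1+k]≤n) (≤-trans (s≤s z≤n) k<log)

claim3p2 : (∃[ C ] ((n : ℕ) (G₁ G₂ : Graph n) → greedyTime G₁ G₂ ≤ C * n ^ 3))
           × (∃[ C ] ((k : ℕ) → ∃[ N ] ((n : ℕ) → N ≤ n →
               suc k * badCount n (C * (n ^ 2 * ⌊log₂ n ⌋)) ≤ totalCount n)))
claim3p2 = (6 , greedyTime-cubic) , (34 , λ k → 2 ^ suc k , slow-runs-rare k)
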